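{- Let $m\ge2$, $s\in(0,1)$, let $X_1,\dots,X_m\sim\mathrm{Bern}(s)$ be i.i.d., and $B=X_1+\cdots+X_m$. For $\ell\in\{1,\dots,\lfloor m/2\rfloor\}$ define $T_\ell=(X_1+\cdots+X_\ell)(X_{\ell+1}+\cdots+X_m)$. Then for any $\ell_1<\ell_2$ in $\{1,\dots,\lfloor m/2\rfloor\}$, any $t\in\mathbb{R}$ and any $b\in\{0,1,\dots,m\}$, $$\mathbb{P}(T_{\ell_1}>t\mid B=b)\le\mathbb{P}(T_{\ell_2}>t\mid B=b).$$
   Formalization: The parameter s and the number t range over the rationals rather than the reals. -}

module Defs where

open import Data.Bool using (Bool; true; false; not; _∧_; if_then_else_)
open import Data.Nat as ℕ using (ℕ; zero; suc)
open import Data.Integer using (+_)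
open import Data.List as List using (List; []; _∷_; take; drop; map; _++_)
open import Data.Vec as Vec using (Vec; []; _∷_; toList)
open import Data.Rational using (ℚ; 0ℚ; 1ℚ; _+_; _*_; _-_; _/_; _÷_; _≤ᵇ_; ≢-nonZero)
open import Data.Rational.Properties using (_≟_)
open import Relation.Nullary using (yes; no)

-- Sample space of (X₁,…,X_m) ∈ {0,1}^m, coded as Vec Bool m (true = 1).
Outcome : ℕ → Set
Outcome m = Vec Bool m

allOutcomes : (m : ℕ) → List (Outcome m)
allOutcomes zero    = [] ∷ []
allOutcomes (suc m) = map (true ∷_) (allOutcomes m) ++ map (false ∷_) (allOutcomes m)

ones : List Bool → ℕ
ones []          = 0
ones (true ∷ xs)  = suc (ones xs)
ones (false ∷ xs) = ones xs

toℚ : ℕ → ℚ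
toℚ n = + n / 1

Bsum : ∀ {m} → Outcome m → ℕ
Bsum x = ones (toList x)

T : ∀ {m} → ℕ → Outcome m → ℕ
T ℓ x = ones (take ℓ (toList x)) ℕ.* ones (drop ℓ (toList x))

weight : ∀ {m} → ℚ → Outcome m → ℚ
weight s []          = 1ℚ
weight s (true ∷ x)  = s * weight s x
weight s (false ∷ x) = (1ℚ - s) * weight s x

sumℚ : List ℚ → ℚ
sumℚ []       = 0ℚ
sumℚ (q ∷ qs) = q + sumℚ qs

Prob : (m : ℕ) → ℚ → (Outcome m → Bool) → ℚ
Prob m s E = sumℚ (map (λ x → if E x then weight s x else 0ℚ) (allOutcomes m))

-- conditional probability ℙ_s(A ∣ C) = ℙ(A ∩ C) / ℙ(C)  (set to 0 if ℙ(C) = 0,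
-- which never happens in the statement since 0 < s < 1)
CondProb : (m : ℕ) → ℚ → (Outcome m → Bool) → (Outcome m → Bool) → ℚ
CondProb m s A C with Prob m s C ≟ 0ℚ
... | yes _  = 0ℚ
... | no p≢0 = _÷_ (Prob m s (λ x → A x ∧ C x)) (Prob m s C) {{≢-nonZero p≢0}}

T>_ : ∀ {m} → ℕ → ℚ → Outcome m → Bool
(T> ℓ) t x = not (toℚ (T ℓ x) ≤ᵇ t)

B=_ : ∀ {m} → ℕ → Outcome m → Bool
(B= b) x = Bsum x ℕ.≡ᵇ b

{-# OPTIONS --safe #-}
-- Given B = b every outcome has probability s^b (1 - s)^(m - b), so both sides are ratios of
-- counts over the same denominator, and it suffices that the number N(ℓ) of outcomes with B = b
-- and T_ℓ > t does not decrease from ℓ to ℓ + 1 when ℓ + ℓ < m.  Let a and r be the numbers of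
-- ones among X₁ … X_ℓ and among the L = m - ℓ - 1 variables after X_{ℓ+1}.  Outcomes with
-- X_{ℓ+1} = 0 count equally for N(ℓ) and N(ℓ + 1); those with X_{ℓ+1} = 1 contribute the sums
-- of C(ℓ,a) C(L,r) over the pairs with a + r + 1 = b and a(r + 1) > t, resp. (a + 1) r > t.
-- A pair satisfying only the first condition has r < a, and its transpose (r, a) satisfies only
-- the second, with weight C(ℓ,r) C(L,a) ≥ C(ℓ,a) C(L,r) because ℓ ≤ L (binomial coefficients
-- are log-supermodular).
module Submission where

open import Defs
open import Data.Bool using (Bool; true; false; not; _∧_; if_then_else_) renaming (T to Tᵇ)
open import Data.Bool.Properties using (T-∧)
open import Data.Fin using (Fin; zero; suc; toℕ)
import Data.Integer as ℤ
import Data.Integer.Properties as ℤ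
open import Data.List using (List; []; _∷_; _++_; map; take; drop)
open import Data.List.Properties using (map-++; map-∘; map-cong; take++drop≡id)
open import Data.Nat hiding (_^_)
open import Data.Nat.Combinatorics using (_C_; nC1≡n; k>n⇒nCk≡0; nCk+nC[k+1]≡[n+1]C[k+1])
import Data.Nat.Coprimality as Coprimality
open import Data.Nat.DivMod using (m/n*n≤m)
open import Data.Nat.ListAction using () renaming (sum to sumₗ)
open import Data.Nat.ListAction.Properties using () renaming (sum-++ to sumₗ-++)
open import Data.Nat.Properties
open import Data.Nat.Tactic.RingSolver using (solve-∀)
open import Data.Product using (_,_; proj₂)
open import Data.Rational as ℚ using (ℚ; 0ℚ; 1ℚ) renaming (_<_ to _<ℚ_; _≤_ to _≤ℚ_)
import Data.Rational.Properties as ℚ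
open import Data.Unit using (tt)
open import Data.Vec using ([]; _∷_; toList)
open import Data.Vec.Functional using (Vector)
open import Function using (_∘_; Equivalence)
open import Relation.Binary.PropositionalEquality
open import Relation.Nullary using (¬_; yes; no)

open import Algebra.Properties.CommutativeSemigroup +-commutativeSemigroup using ()
  renaming (x∙yz≈y∙xz to x+[y+z]≡y+[x+z]; xy∙z≈xz∙y to x+y+z≡x+z+y; interchange to +-interchange)
open import Algebra.Properties.CommutativeSemigroup *-commutativeSemigroup using ()
  renaming (x∙yz≈y∙xz to x*[y*z]≡y*[x*z])
open import Algebra.Properties.Semiring.Sum +-*-semiring
  using (sum; sum-syntax; ∑-comm; ∑-distrib-+; sum-cong-≗; *-distribˡ-sum; sum-replicate-zero)
open import Algebra.Definitions.RawSemiring ℚ.+-*-rawSemiring using (_×_; _^_)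

[k+1]*[n+1]C[k+1]≡[n+1]*nCk : ∀ n k → suc k * (suc n C suc k) ≡ suc n * (n C k)
[k+1]*[n+1]C[k+1]≡[n+1]*nCk zero    zero    = refl
[k+1]*[n+1]C[k+1]≡[n+1]*nCk zero    (suc k) = *-zeroʳ (2 + k)
[k+1]*[n+1]C[k+1]≡[n+1]*nCk (suc n) zero    =
  trans (*-identityˡ _) (trans (nC1≡n (2 + n)) (sym (*-identityʳ (2 + n))))
[k+1]*[n+1]C[k+1]≡[n+1]*nCk (suc n) (suc k) = begin
  suc (suc k) * (suc (suc n) C suc (suc k))
    ≡⟨ cong (suc (suc k) *_) (nCk+nC[k+1]≡[n+1]C[k+1] (suc n) (suc k)) ⟨
  suc (suc k) * (X + suc n C suc (suc k))
    ≡⟨ *-distribˡ-+ (suc (suc k)) X _ ⟩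
  X + suc k * X + suc (suc k) * (suc n C suc (suc k))
    ≡⟨ cong₂ (λ u v → X + u + v) ([k+1]*[n+1]C[k+1]≡[n+1]*nCk n k)
                                  ([k+1]*[n+1]C[k+1]≡[n+1]*nCk n (suc k)) ⟩
  X + suc n * (n C k) + suc n * (n C suc k)
    ≡⟨ +-assoc X _ _ ⟩
  X + (suc n * (n C k) + suc n * (n C suc k))
    ≡⟨ cong (X +_) (*-distribˡ-+ (suc n) (n C k) _) ⟨
  X + suc n * (n C k + n C suc k)
    ≡⟨ cong (λ z → X + suc n * z) (nCk+nC[k+1]≡[n+1]C[k+1] n k) ⟩
  suc (suc n) * X ∎
  where
  open ≡-Reasoning
  X = suc n C suc k

[n+1]*[n+1]Ck≡[n+1]*nCk+k*[n+1]Ck : ∀ n k → suc n * (suc n C k) ≡ suc n * (n C k) + k * (suc n C k)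
[n+1]*[n+1]Ck≡[n+1]*nCk+k*[n+1]Ck n zero    = sym (+-identityʳ _)
[n+1]*[n+1]Ck≡[n+1]*nCk+k*[n+1]Ck n (suc k) = begin
  suc n * (suc n C suc k)                 ≡⟨ cong (suc n *_) (nCk+nC[k+1]≡[n+1]C[k+1] n k) ⟨
  suc n * (n C k + n C suc k)             ≡⟨ *-distribˡ-+ (suc n) (n C k) _ ⟩
  suc n * (n C k) + Y                     ≡⟨ cong (_+ Y) ([k+1]*[n+1]C[k+1]≡[n+1]*nCk n k) ⟨
  suc k * (suc n C suc k) + Y             ≡⟨ +-comm (suc k * (suc n C suc k)) Y ⟩
  Y + suc k * (suc n C suc k)             ∎
  where
  open ≡-Reasoning
  Y = suc n * (n C suc k)

*-cancel-cross-≤ : ∀ {a n x y} → a < n → n * x + a * y ≤ n * y + a * x → x ≤ y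
*-cancel-cross-≤ {a} {n} {x} {y} a<n le = *-cancelˡ-≤ (n ∸ a) {{>-nonZero (m<n⇒0<n∸m a<n)}}
  (+-cancelʳ-≤ (a * x + a * y) _ _
    (subst₂ _≤_ (split x y) (trans (split y x) (cong ((n ∸ a) * y +_) (+-comm (a * y) (a * x)))) le))
  where
  regroup : ∀ a d u v → (a + d) * u + a * v ≡ d * u + (a * u + a * v)
  regroup = solve-∀
  split : ∀ u v → n * u + a * v ≡ (n ∸ a) * u + (a * u + a * v)
  split u v = subst (λ n′ → n′ * u + a * v ≡ (n ∸ a) * u + (a * u + a * v))
                    (m+[n∸m]≡n (<⇒≤ a<n)) (regroup a (n ∸ a) u v)

ℓCa*[L+1]Cr≤ℓCr*[L+1]Ca : ∀ {ℓ L a r} → a ≤ L → r ≤ a →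
                          (ℓ C a) * (L C r) ≤ (ℓ C r) * (L C a) →
                          (ℓ C a) * (suc L C r) ≤ (ℓ C r) * (suc L C a)
ℓCa*[L+1]Cr≤ℓCr*[L+1]Ca {ℓ} {L} {a} {r} a≤L r≤a ih = *-cancel-cross-≤ (s≤s a≤L) (begin
  suc L * X + a * Y                   ≡⟨ cong (_+ a * Y) (scale (ℓ C a) r) ⟩
  suc L * U + r * X + a * Y           ≤⟨ +-monoˡ-≤ (a * Y) (+-mono-≤ (*-monoʳ-≤ (suc L) ih) rX≤aX) ⟩
  suc L * V + a * X + a * Y           ≡⟨ x+y+z≡x+z+y (suc L * V) (a * X) (a * Y) ⟩
  suc L * V + a * Y + a * X           ≡⟨ cong (_+ a * X) (scale (ℓ C r) a) ⟨
  suc L * Y + a * X                   ∎)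
  where
  open ≤-Reasoning
  X = (ℓ C a) * (suc L C r)
  Y = (ℓ C r) * (suc L C a)
  U = (ℓ C a) * (L C r)
  V = (ℓ C r) * (L C a)
  rX≤aX : r * X ≤ a * X
  rX≤aX = *-monoˡ-≤ X r≤a
  distribute : ∀ c n p k q → c * (n * p + k * q) ≡ n * (c * p) + k * (c * q)
  distribute = solve-∀
  scale : ∀ c k → suc L * (c * (suc L C k)) ≡ suc L * (c * (L C k)) + k * (c * (suc L C k))
  scale c k = begin-equality
    suc L * (c * (suc L C k))                     ≡⟨ x*[y*z]≡y*[x*z] (suc L) c _ ⟩
    c * (suc L * (suc L C k))                     ≡⟨ cong (c *_) ([n+1]*[n+1]Ck≡[n+1]*nCk+k*[n+1]Ck L k) ⟩
    c * (suc L * (L C k) + k * (suc L C k))       ≡⟨ distribute c (suc L) (L C k) k _ ⟩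
    suc L * (c * (L C k)) + k * (c * (suc L C k)) ∎

ℓCa*LCr≤ℓCr*LCa : ∀ {ℓ L a r} → r ≤ a → ℓ ≤ L → (ℓ C a) * (L C r) ≤ (ℓ C r) * (L C a)
ℓCa*LCr≤ℓCr*LCa {ℓ} {L} {a} {r} r≤a ℓ≤L with a ≤? ℓ
... | no a≰ℓ rewrite k>n⇒nCk≡0 (≰⇒> a≰ℓ) = z≤n
... | yes a≤ℓ = go (≤⇒≤′ ℓ≤L)
  where
  go : ∀ {L} → ℓ ≤′ L → (ℓ C a) * (L C r) ≤ (ℓ C r) * (L C a)
  go ≤′-refl            = ≤-reflexive (*-comm (ℓ C a) (ℓ C r))
  go (≤′-step ℓ≤′L) = ℓCa*[L+1]Cr≤ℓCr*[L+1]Ca (≤-trans a≤ℓ (≤′⇒≤ ℓ≤′L)) r≤a (go ℓ≤′L)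

ind : Bool → ℕ
ind true  = 1
ind false = 0

∑-mono-≤ : ∀ {n} {f g : Vector ℕ n} → (∀ i → f i ≤ g i) → sum f ≤ sum g
∑-mono-≤ {zero}  _   = z≤n
∑-mono-≤ {suc n} f≤g = +-mono-≤ (f≤g zero) (∑-mono-≤ (f≤g ∘ suc))

∑∑-symmetrise : ∀ {n} (F : Fin n → Fin n → ℕ) →
                ∑[ i < n ] ∑[ j < n ] F i j + ∑[ i < n ] ∑[ j < n ] F i j ≡
                ∑[ i < n ] ∑[ j < n ] (F i j + F j i)
∑∑-symmetrise {n} F = begin
  ∑[ i < n ] ∑[ j < n ] F i j + ∑[ i < n ] ∑[ j < n ] F i j
    ≡⟨ cong (∑[ i < n ] ∑[ j < n ] F i j +_) (∑-comm F) ⟩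
  ∑[ i < n ] ∑[ j < n ] F i j + ∑[ i < n ] ∑[ j < n ] F j i
    ≡⟨ ∑-distrib-+ (λ i → ∑[ j < n ] F i j) (λ i → ∑[ j < n ] F j i) ⟨
  ∑[ i < n ] (∑[ j < n ] F i j + ∑[ j < n ] F j i)
    ≡⟨ sum-cong-≗ (λ i → ∑-distrib-+ (F i) (λ j → F j i)) ⟨
  ∑[ i < n ] ∑[ j < n ] (F i j + F j i) ∎
  where open ≡-Reasoning

∑∑-mono-symmetrised : ∀ {n} (F G : Fin n → Fin n → ℕ) →
                      (∀ i j → F i j + F j i ≤ G i j + G j i) →
                      ∑[ i < n ] ∑[ j < n ] F i j ≤ ∑[ i < n ] ∑[ j < n ] G i j
∑∑-mono-symmetrised F G F≤G = halve (begin
  ∑[ i < _ ] ∑[ j < _ ] F i j + ∑[ i < _ ] ∑[ j < _ ] F i j ≡⟨ ∑∑-symmetrise F ⟩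
  ∑[ i < _ ] ∑[ j < _ ] (F i j + F j i)                     ≤⟨ ∑-mono-≤ (λ i → ∑-mono-≤ (F≤G i)) ⟩
  ∑[ i < _ ] ∑[ j < _ ] (G i j + G j i)                     ≡⟨ ∑∑-symmetrise G ⟨
  ∑[ i < _ ] ∑[ j < _ ] G i j + ∑[ i < _ ] ∑[ j < _ ] G i j ∎)
  where
  open ≤-Reasoning
  halve : ∀ {x y} → x + x ≤ y + y → x ≤ y
  halve x+x≤y+y = ≮⇒≥ (λ y<x → <⇒≱ (+-mono-< y<x y<x) x+x≤y+y)

*ind-transpose-≤ : ∀ u v β γ → (Tᵇ β → ¬ Tᵇ γ → u ≤ v) → (Tᵇ γ → ¬ Tᵇ β → v ≤ u) →
                   u * ind β + v * ind γ ≤ u * ind γ + v * ind β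
*ind-transpose-≤ u v true  true  _    _    = ≤-refl
*ind-transpose-≤ u v false false _    _    = ≤-refl
*ind-transpose-≤ u v true  false u≤v  _
  rewrite *-identityʳ u | *-identityʳ v | *-zeroʳ u | *-zeroʳ v | +-identityʳ u = u≤v tt (λ ())
*ind-transpose-≤ u v false true  _    v≤u
  rewrite *-identityʳ u | *-identityʳ v | *-zeroʳ u | *-zeroʳ v | +-identityʳ u = v≤u tt (λ ())

∑∑-transpose-≤ : ∀ {n} (w : Fin n → Fin n → ℕ) (p : Fin n → Fin n → Bool) →
                 (∀ i j → Tᵇ (p i j) → ¬ Tᵇ (p j i) → w i j ≤ w j i) →
                 ∑[ i < n ] ∑[ j < n ] (w i j * ind (p i j)) ≤ ∑[ i < n ] ∑[ j < n ] (w i j * ind (p j i))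
∑∑-transpose-≤ w p favours = ∑∑-mono-symmetrised _ _ (λ i j →
  *ind-transpose-≤ (w i j) (w j i) (p i j) (p j i) (favours i j) (favours j i))

binomialSum : ℕ → (ℕ → ℕ) → ℕ
binomialSum zero    f = f 0
binomialSum (suc n) f = binomialSum n (f ∘ suc) + binomialSum n f

binomialSum-cong : ∀ n {f g : ℕ → ℕ} → (∀ k → f k ≡ g k) → binomialSum n f ≡ binomialSum n g
binomialSum-cong zero    f≗g = f≗g 0
binomialSum-cong (suc n) f≗g = cong₂ _+_ (binomialSum-cong n (f≗g ∘ suc)) (binomialSum-cong n f≗g)

binomialSum-+ : ∀ n (f g : ℕ → ℕ) → binomialSum n (λ k → f k + g k) ≡ binomialSum n f + binomialSum n g
binomialSum-+ zero    f g = refl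
binomialSum-+ (suc n) f g = begin
  binomialSum n (λ k → f (suc k) + g (suc k)) + binomialSum n (λ k → f k + g k)
    ≡⟨ cong₂ _+_ (binomialSum-+ n (f ∘ suc) (g ∘ suc)) (binomialSum-+ n f g) ⟩
  (binomialSum n (f ∘ suc) + binomialSum n (g ∘ suc)) + (binomialSum n f + binomialSum n g)
    ≡⟨ +-interchange (binomialSum n (f ∘ suc)) _ _ _ ⟩
  binomialSum (suc n) f + binomialSum (suc n) g ∎
  where open ≡-Reasoning

binomialSum≡∑ : ∀ {n N} (f : ℕ → ℕ) → n < N → binomialSum n f ≡ ∑[ k < N ] ((n C toℕ k) * f (toℕ k))
binomialSum≡∑ {zero}  {suc N} f _ =
  sym (trans (cong (1 * f 0 +_) (sum-replicate-zero N)) (trans (+-identityʳ (1 * f 0)) (*-identityˡ (f 0))))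
binomialSum≡∑ {suc n} {suc N} f (s≤s n<N) = begin
  binomialSum n (f ∘ suc) + binomialSum n f
    ≡⟨ cong₂ _+_ (binomialSum≡∑ (f ∘ suc) n<N) (binomialSum≡∑ f (m<n⇒m<1+n n<N)) ⟩
  ∑[ k < N ] ((n C toℕ k) * f′ k) + (1 * f 0 + ∑[ k < N ] ((n C suc (toℕ k)) * f′ k))
    ≡⟨ x+[y+z]≡y+[x+z] (∑[ k < N ] ((n C toℕ k) * f′ k)) (1 * f 0) _ ⟩
  1 * f 0 + (∑[ k < N ] ((n C toℕ k) * f′ k) + ∑[ k < N ] ((n C suc (toℕ k)) * f′ k))
    ≡⟨ cong (1 * f 0 +_) (∑-distrib-+ {N} (λ k → (n C toℕ k) * f′ k) _) ⟨
  1 * f 0 + ∑[ k < N ] ((n C toℕ k) * f′ k + (n C suc (toℕ k)) * f′ k)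
    ≡⟨ cong (1 * f 0 +_) (sum-cong-≗ {N} pascal) ⟩
  1 * f 0 + ∑[ k < N ] ((suc n C suc (toℕ k)) * f′ k) ∎
  where
  open ≡-Reasoning
  f′ : Fin N → ℕ
  f′ k = f (suc (toℕ k))
  pascal : ∀ k → (n C toℕ k) * f′ k + (n C suc (toℕ k)) * f′ k ≡ (suc n C suc (toℕ k)) * f′ k
  pascal k = trans (sym (*-distribʳ-+ (f′ k) (n C toℕ k) _))
                   (cong (_* f′ k) (nCk+nC[k+1]≡[n+1]C[k+1] n (toℕ k)))

binomialSum²≡∑∑ : ∀ {ℓ L N} (h : ℕ → ℕ → ℕ) → ℓ < N → L < N →
                  binomialSum ℓ (λ a → binomialSum L (h a)) ≡
                  ∑[ i < N ] ∑[ j < N ] ((ℓ C toℕ i) * (L C toℕ j) * h (toℕ i) (toℕ j))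
binomialSum²≡∑∑ {ℓ} {L} {N} h ℓ<N L<N = trans (binomialSum≡∑ _ ℓ<N) (sum-cong-≗ {N} λ i → begin
  (ℓ C toℕ i) * binomialSum L (h (toℕ i))
    ≡⟨ cong ((ℓ C toℕ i) *_) (binomialSum≡∑ (h (toℕ i)) L<N) ⟩
  (ℓ C toℕ i) * ∑[ j < N ] ((L C toℕ j) * h (toℕ i) (toℕ j))
    ≡⟨ *-distribˡ-sum {N} (ℓ C toℕ i) _ ⟩
  ∑[ j < N ] ((ℓ C toℕ i) * ((L C toℕ j) * h (toℕ i) (toℕ j)))
    ≡⟨ sum-cong-≗ {N} (λ j → *-assoc (ℓ C toℕ i) (L C toℕ j) (h (toℕ i) (toℕ j))) ⟨
  ∑[ j < N ] ((ℓ C toℕ i) * (L C toℕ j) * h (toℕ i) (toℕ j)) ∎)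
  where open ≡-Reasoning

binomialSum²-transpose-≤ : ∀ {ℓ L} (p : ℕ → ℕ → Bool) → ℓ ≤ L →
                           (∀ a r → Tᵇ (p a r) → ¬ Tᵇ (p r a) → r ≤ a) →
                           binomialSum ℓ (λ a → binomialSum L (λ r → ind (p a r))) ≤
                           binomialSum ℓ (λ a → binomialSum L (λ r → ind (p r a)))
binomialSum²-transpose-≤ {ℓ} {L} p ℓ≤L favours = begin
  binomialSum ℓ (λ a → binomialSum L (λ r → ind (p a r)))
    ≡⟨ binomialSum²≡∑∑ (λ a r → ind (p a r)) (s≤s ℓ≤L) ≤-refl ⟩
  ∑[ i < suc L ] ∑[ j < suc L ] (w i j * ind (p (toℕ i) (toℕ j)))
    ≤⟨ ∑∑-transpose-≤ w (λ i j → p (toℕ i) (toℕ j))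
         (λ i j pij ¬pji → ℓCa*LCr≤ℓCr*LCa (favours (toℕ i) (toℕ j) pij ¬pji) ℓ≤L) ⟩
  ∑[ i < suc L ] ∑[ j < suc L ] (w i j * ind (p (toℕ j) (toℕ i)))
    ≡⟨ binomialSum²≡∑∑ (λ a r → ind (p r a)) (s≤s ℓ≤L) ≤-refl ⟨
  binomialSum ℓ (λ a → binomialSum L (λ r → ind (p r a))) ∎
  where
  open ≤-Reasoning
  w : Fin (suc L) → Fin (suc L) → ℕ
  w i j = (ℓ C toℕ i) * (L C toℕ j)

binomialSum²-shift-≤ : ∀ {ℓ L} (Q : ℕ → ℕ → Bool) → (∀ a r → Q a r ≡ Q r a) →
                         (∀ {a r} → a < r → Tᵇ (Q a (suc r)) → Tᵇ (Q (suc a) r)) → ℓ ≤ L →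
                         binomialSum ℓ (λ a → binomialSum (suc L) (λ r → ind (Q a r))) ≤
                         binomialSum (suc ℓ) (λ a → binomialSum L (λ r → ind (Q a r)))
binomialSum²-shift-≤ {ℓ} {L} Q Q-sym balance ℓ≤L = begin
  binomialSum ℓ (λ a → binomialSum L (λ r → ind (Q a (suc r))) + rest a)
    ≡⟨ binomialSum-+ ℓ (λ a → binomialSum L (λ r → ind (Q a (suc r)))) rest ⟩
  binomialSum ℓ (λ a → binomialSum L (λ r → ind (Q a (suc r)))) + binomialSum ℓ rest
    ≤⟨ +-monoˡ-≤ (binomialSum ℓ rest) (binomialSum²-transpose-≤ (λ a r → Q a (suc r)) ℓ≤L favours) ⟩
  binomialSum ℓ (λ a → binomialSum L (λ r → ind (Q r (suc a)))) + binomialSum ℓ rest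
    ≡⟨ cong (_+ binomialSum ℓ rest)
         (binomialSum-cong ℓ λ a → binomialSum-cong L λ r → cong ind (Q-sym r (suc a))) ⟩
  binomialSum ℓ (λ a → binomialSum L (λ r → ind (Q (suc a) r))) + binomialSum ℓ rest ∎
  where
  open ≤-Reasoning
  rest : ℕ → ℕ
  rest a = binomialSum L (λ r → ind (Q a r))
  favours : ∀ a r → Tᵇ (Q a (suc r)) → ¬ Tᵇ (Q r (suc a)) → r ≤ a
  favours a r q ¬q′ = ≮⇒≥ (λ a<r → ¬q′ (subst Tᵇ (Q-sym (suc a) r) (balance a<r q)))

count : ∀ {A : Set} → (A → Bool) → List A → ℕ
count P xs = sumₗ (map (ind ∘ P) xs)

count-cong : ∀ {A : Set} {P P′ : A → Bool} (xs : List A) → (∀ x → P x ≡ P′ x) → count P xs ≡ count P′ xs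
count-cong xs P≗P′ = cong sumₗ (map-cong (cong ind ∘ P≗P′) xs)

count-allOutcomes-suc : ∀ {m} (P : Outcome (suc m) → Bool) →
                        count P (allOutcomes (suc m)) ≡
                        count (P ∘ (true ∷_)) (allOutcomes m) + count (P ∘ (false ∷_)) (allOutcomes m)
count-allOutcomes-suc {m} P = begin
  sumₗ (map (ind ∘ P) (map (true ∷_) xs ++ map (false ∷_) xs))
    ≡⟨ cong sumₗ (map-++ (ind ∘ P) (map (true ∷_) xs) _) ⟩
  sumₗ (map (ind ∘ P) (map (true ∷_) xs) ++ map (ind ∘ P) (map (false ∷_) xs))
    ≡⟨ sumₗ-++ (map (ind ∘ P) (map (true ∷_) xs)) _ ⟩
  sumₗ (map (ind ∘ P) (map (true ∷_) xs)) + sumₗ (map (ind ∘ P) (map (false ∷_) xs))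
    ≡⟨ cong₂ (λ u v → sumₗ u + sumₗ v) (map-∘ xs) (map-∘ xs) ⟨
  count (P ∘ (true ∷_)) xs + count (P ∘ (false ∷_)) xs ∎
  where
  open ≡-Reasoning
  xs = allOutcomes m

ones-++ : ∀ xs ys → ones (xs ++ ys) ≡ ones xs + ones ys
ones-++ []           ys = refl
ones-++ (true ∷ xs)  ys = cong suc (ones-++ xs ys)
ones-++ (false ∷ xs) ys = ones-++ xs ys

ones-take+ones-drop : ∀ ℓ xs → ones (take ℓ xs) + ones (drop ℓ xs) ≡ ones xs
ones-take+ones-drop ℓ xs = trans (sym (ones-++ (take ℓ xs) (drop ℓ xs))) (cong ones (take++drop≡id ℓ xs))

onBlocks : ∀ {m} → ℕ → (ℕ → ℕ → Bool) → Outcome m → Bool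
onBlocks ℓ Q x = Q (ones (take ℓ (toList x))) (ones (drop ℓ (toList x)))

count-onBlocks : ∀ {ℓ L m} (Q : ℕ → ℕ → Bool) → ℓ + L ≡ m →
                 count (onBlocks ℓ Q) (allOutcomes m) ≡
                 binomialSum ℓ (λ a → binomialSum L (λ r → ind (Q a r)))
count-onBlocks {zero}  {zero}  Q refl = +-identityʳ (ind (Q 0 0))
count-onBlocks {zero}  {suc L} Q refl = trans (count-allOutcomes-suc {L} (onBlocks 0 Q))
  (cong₂ _+_ (count-onBlocks {0} {L} (λ a r → Q a (suc r)) refl) (count-onBlocks {0} {L} Q refl))
count-onBlocks {suc ℓ} {L}     Q refl = trans (count-allOutcomes-suc {ℓ + L} (onBlocks (suc ℓ) Q))
  (cong₂ _+_ (count-onBlocks {ℓ} {L} (Q ∘ suc) refl) (count-onBlocks {ℓ} {L} Q refl))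

m≤n/2⇒m+m≤n : ∀ {m n} → m ≤ n / 2 → m + m ≤ n
m≤n/2⇒m+m≤n {m} {n} m≤n/2 = ≤-trans (subst (_≤ n / 2 * 2) m*2≡m+m (*-monoˡ-≤ 2 m≤n/2)) (m/n*n≤m n 2)
  where
  m*2≡m+m : m * 2 ≡ m + m
  m*2≡m+m = trans (*-comm m 2) (cong (m +_) (+-identityʳ m))

toℚ≡mkℚ : ∀ n → toℚ n ≡ ℚ.mkℚ (ℤ.+ n) 0 (Coprimality.sym (Coprimality.1-coprimeTo n))
toℚ≡mkℚ n = ℚ.normalize-coprime (Coprimality.sym (Coprimality.1-coprimeTo n))

toℚ-mono-≤ : ∀ {m n} → m ≤ n → toℚ m ≤ℚ toℚ n
toℚ-mono-≤ {m} {n} m≤n rewrite toℚ≡mkℚ m | toℚ≡mkℚ n =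
  ℚ.*≤* (subst₂ ℤ._≤_ (sym (ℤ.*-identityʳ (ℤ.+ m))) (sym (ℤ.*-identityʳ (ℤ.+ n))) (ℤ.+≤+ m≤n))

not-antitone : ∀ {x y} → (Tᵇ y → Tᵇ x) → Tᵇ (not x) → Tᵇ (not y)
not-antitone {false} {false} _   _ = tt
not-antitone {false} {true}  y⇒x _ = y⇒x tt
not-antitone {true}          _   ()

exceeds-mono : ∀ {t m n} → m ≤ n → Tᵇ (not (toℚ m ℚ.≤ᵇ t)) → Tᵇ (not (toℚ n ℚ.≤ᵇ t))
exceeds-mono {t} {m} {n} m≤n =
  not-antitone (λ n≤t → ℚ.≤⇒≤ᵇ (ℚ.≤-trans {toℚ m} {toℚ n} {t} (toℚ-mono-≤ m≤n) (ℚ.≤ᵇ⇒≤ n≤t)))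

module _ (t : ℚ) (b : ℕ) where

  blockEvent : ℕ → ℕ → Bool
  blockEvent a r = not (toℚ (a * r) ℚ.≤ᵇ t) ∧ (a + r ≡ᵇ b)

  blockEvent-sym : ∀ a r → blockEvent a r ≡ blockEvent r a
  blockEvent-sym a r = cong₂ (λ u v → not (toℚ u ℚ.≤ᵇ t) ∧ (v ≡ᵇ b)) (*-comm a r) (+-comm a r)

  blockEvent-balance : ∀ {a r} → a < r → Tᵇ (blockEvent a (suc r)) → Tᵇ (blockEvent (suc a) r)
  blockEvent-balance {a} {r} a<r event with Equivalence.to T-∧ event
  ... | exceeds , sums = Equivalence.from (T-∧ {not (toℚ (suc a * r) ℚ.≤ᵇ t)})
    (exceeds-mono {t} a*[1+r]≤[1+a]*r exceeds , subst (λ z → Tᵇ (z ≡ᵇ b)) (+-suc a r) sums)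
    where
    a*[1+r]≤[1+a]*r : a * suc r ≤ suc a * r
    a*[1+r]≤[1+a]*r = subst (_≤ suc a * r) (sym (*-suc a r)) (+-monoˡ-≤ (a * r) (<⇒≤ a<r))

  T>∧B=≡onBlocks : ∀ {m} ℓ (x : Outcome m) → ((T> ℓ) t x ∧ (B= b) x) ≡ onBlocks ℓ blockEvent x
  T>∧B=≡onBlocks ℓ x = cong (λ z → (T> ℓ) t x ∧ (z ≡ᵇ b)) (sym (ones-take+ones-drop ℓ (toList x)))

  #T>∧B= : ℕ → ℕ → ℕ
  #T>∧B= m ℓ = count (λ x → (T> ℓ) t x ∧ (B= b) x) (allOutcomes m)

  #T>∧B=≡binomialSum² : ∀ {ℓ L m} → ℓ + L ≡ m →
                        #T>∧B= m ℓ ≡ binomialSum ℓ (λ a → binomialSum L (λ r → ind (blockEvent a r)))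
  #T>∧B=≡binomialSum² {ℓ} {L} {m} ℓ+L≡m =
    trans (count-cong (allOutcomes m) (T>∧B=≡onBlocks {m} ℓ)) (count-onBlocks {ℓ} {L} blockEvent ℓ+L≡m)

  #T>∧B=-step : ∀ {m ℓ} → ℓ + suc ℓ ≤ m → #T>∧B= m ℓ ≤ #T>∧B= m (suc ℓ)
  #T>∧B=-step {m} {ℓ} ℓ+[1+ℓ]≤m = begin
    #T>∧B= m ℓ
      ≡⟨ #T>∧B=≡binomialSum² {ℓ} {suc L} (trans (+-suc ℓ L) [1+ℓ]+L≡m) ⟩
    binomialSum ℓ (λ a → binomialSum (suc L) (λ r → ind (blockEvent a r)))
      ≤⟨ binomialSum²-shift-≤ blockEvent blockEvent-sym blockEvent-balance (m+n≤o⇒m≤o∸n ℓ ℓ+[1+ℓ]≤m) ⟩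
    binomialSum (suc ℓ) (λ a → binomialSum L (λ r → ind (blockEvent a r)))
      ≡⟨ #T>∧B=≡binomialSum² {suc ℓ} {L} [1+ℓ]+L≡m ⟨
    #T>∧B= m (suc ℓ) ∎
    where
    open ≤-Reasoning
    L = m ∸ suc ℓ
    [1+ℓ]+L≡m : suc ℓ + L ≡ m
    [1+ℓ]+L≡m = m+[n∸m]≡n (m+n≤o⇒n≤o ℓ ℓ+[1+ℓ]≤m)

  #T>∧B=-mono : ∀ {m ℓ₁ ℓ₂} → ℓ₁ ≤ ℓ₂ → ℓ₂ + ℓ₂ ≤ m → #T>∧B= m ℓ₁ ≤ #T>∧B= m ℓ₂
  #T>∧B=-mono {m} {ℓ₁} ℓ₁≤ℓ₂ = go (≤⇒≤′ ℓ₁≤ℓ₂)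
    where
    go : ∀ {ℓ₂} → ℓ₁ ≤′ ℓ₂ → ℓ₂ + ℓ₂ ≤ m → #T>∧B= m ℓ₁ ≤ #T>∧B= m ℓ₂
    go ≤′-refl               _ = ≤-refl
    go (≤′-step {k} ℓ₁≤′k) [1+k]+[1+k]≤m = ≤-trans
      (go ℓ₁≤′k (≤-trans (+-mono-≤ (n≤1+n k) (n≤1+n k)) [1+k]+[1+k]≤m))
      (#T>∧B=-step (≤-trans (+-monoˡ-≤ (suc k) (n≤1+n k)) [1+k]+[1+k]≤m))

*-nonNeg : ∀ {p q} → 0ℚ ≤ℚ p → 0ℚ ≤ℚ q → 0ℚ ≤ℚ p ℚ.* q
*-nonNeg {p} {q} 0≤p 0≤q =
  ℚ.nonNegative⁻¹ _ {{ℚ.nonNeg*nonNeg⇒nonNeg p {{ℚ.nonNegative 0≤p}} q {{ℚ.nonNegative 0≤q}}}}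

^-nonNeg : ∀ {s} k → 0ℚ ≤ℚ s → 0ℚ ≤ℚ s ^ k
^-nonNeg zero    _   = ℚ.nonNegative⁻¹ 1ℚ
^-nonNeg (suc k) 0≤s = *-nonNeg 0≤s (^-nonNeg k 0≤s)

×-nonNeg : ∀ {w} n → 0ℚ ≤ℚ w → 0ℚ ≤ℚ n × w
×-nonNeg zero    _   = ℚ.≤-refl
×-nonNeg (suc n) 0≤w = ℚ.+-mono-≤ 0≤w (×-nonNeg n 0≤w)

×-monoˡ-≤ : ∀ {w m n} → 0ℚ ≤ℚ w → m ≤ n → m × w ≤ℚ n × w
×-monoˡ-≤ {n = n} 0≤w z≤n       = ×-nonNeg n 0≤w
×-monoˡ-≤ {w}     0≤w (s≤s m≤n) = ℚ.+-monoʳ-≤ w (×-monoˡ-≤ 0≤w m≤n)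

p≤q⇒0≤q-p : ∀ {p q} → p ≤ℚ q → 0ℚ ≤ℚ q ℚ.- p
p≤q⇒0≤q-p {p} {q} p≤q = subst (_≤ℚ q ℚ.- p) (ℚ.+-inverseʳ p) (ℚ.+-monoˡ-≤ (ℚ.- p) p≤q)

Bsum≤length : ∀ {m} (x : Outcome m) → Bsum x ≤ m
Bsum≤length []          = z≤n
Bsum≤length (true ∷ x)  = s≤s (Bsum≤length x)
Bsum≤length (false ∷ x) = m≤n⇒m≤1+n (Bsum≤length x)

levelWeight : ℕ → ℚ → ℕ → ℚ
levelWeight m s b = s ^ b ℚ.* (1ℚ ℚ.- s) ^ (m ∸ b)

weight≡levelWeight : ∀ {m} s (x : Outcome m) → weight s x ≡ levelWeight m s (Bsum x)
weight≡levelWeight s []          = refl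
weight≡levelWeight s (true ∷ x)  =
  trans (cong (s ℚ.*_) (weight≡levelWeight s x)) (sym (ℚ.*-assoc s _ _))
weight≡levelWeight {suc m} s (false ∷ x) = begin
  q ℚ.* weight s x                   ≡⟨ cong (q ℚ.*_) (weight≡levelWeight s x) ⟩
  q ℚ.* (s ^ b ℚ.* q ^ (m ∸ b))      ≡⟨ ℚ.*-assoc q (s ^ b) _ ⟨
  q ℚ.* s ^ b ℚ.* q ^ (m ∸ b)        ≡⟨ cong (ℚ._* q ^ (m ∸ b)) (ℚ.*-comm q (s ^ b)) ⟩
  s ^ b ℚ.* q ℚ.* q ^ (m ∸ b)        ≡⟨ ℚ.*-assoc (s ^ b) q _ ⟩
  s ^ b ℚ.* q ^ suc (m ∸ b)          ≡⟨ cong (λ k → s ^ b ℚ.* q ^ k) (+-∸-assoc 1 (Bsum≤length x)) ⟨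
  s ^ b ℚ.* q ^ (suc m ∸ b)          ∎
  where
  open ≡-Reasoning
  q = 1ℚ ℚ.- s
  b = Bsum x

Prob≡count×levelWeight : ∀ {m} s b (E : Outcome m → Bool) → (∀ x → Tᵇ (E x) → Bsum x ≡ b) →
                         Prob m s E ≡ count E (allOutcomes m) × levelWeight m s b
Prob≡count×levelWeight {m} s b E E⇒B=b = go (allOutcomes m)
  where
  weight-on-E : ∀ x → E x ≡ true → weight s x ≡ levelWeight m s b
  weight-on-E x Ex rewrite sym (E⇒B=b x (subst Tᵇ (sym Ex) tt)) = weight≡levelWeight s x
  go : ∀ xs → sumℚ (map (λ x → if E x then weight s x else 0ℚ) xs) ≡ count E xs × levelWeight m s b
  go []       = refl
  go (x ∷ xs) with E x in Ex
  ... | true  = cong₂ ℚ._+_ (weight-on-E x Ex) (go xs)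
  ... | false = trans (ℚ.+-identityˡ _) (go xs)

CondProb-monoˡ : ∀ m s {A₁ A₂ C : Outcome m → Bool} → 0ℚ ≤ℚ Prob m s C →
                 Prob m s (λ x → A₁ x ∧ C x) ≤ℚ Prob m s (λ x → A₂ x ∧ C x) →
                 CondProb m s A₁ C ≤ℚ CondProb m s A₂ C
CondProb-monoˡ m s {C = C} 0≤P A₁C≤A₂C with Prob m s C ℚ.≟ 0ℚ
... | yes _   = ℚ.≤-refl
... | no P≢0 = ℚ.*-monoʳ-≤-nonNeg _ {{1/P-nonNeg}} A₁C≤A₂C
  where
  P = Prob m s C
  P-positive : ℚ.Positive P
  P-positive = ℚ.nonNeg∧nonZero⇒pos P {{ℚ.nonNegative 0≤P}} {{ℚ.≢-nonZero P≢0}}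
  1/P-nonNeg : ℚ.NonNegative ((ℚ.1/ P) {{ℚ.pos⇒nonZero P {{P-positive}}}})
  1/P-nonNeg = ℚ.pos⇒nonNeg ((ℚ.1/ P) {{ℚ.pos⇒nonZero P {{P-positive}}}})
                            {{ℚ.1/pos⇒pos P {{P-positive}}}}

lemma15 : (m : ℕ) → 2 ≤ m → (s : ℚ) → 0ℚ <ℚ s → s <ℚ 1ℚ →
          (ℓ₁ ℓ₂ : ℕ) → 1 ≤ ℓ₁ → ℓ₁ < ℓ₂ → ℓ₂ ≤ m / 2 →
          (t : ℚ) → (b : ℕ) → b ≤ m →
          CondProb m s ((T> ℓ₁) t) (B= b) ≤ℚ CondProb m s ((T> ℓ₂) t) (B= b)
lemma15 m _ s 0<s s<1 ℓ₁ ℓ₂ _ ℓ₁<ℓ₂ ℓ₂≤m/2 t b _ = CondProb-monoˡ m s 0≤P[B=b] (begin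
  Prob m s (λ x → (T> ℓ₁) t x ∧ (B= b) x) ≡⟨ Prob≡count×levelWeight s b _ (∧B=b⇒ ((T> ℓ₁) t)) ⟩
  #T>∧B= t b m ℓ₁ × W                     ≤⟨ ×-monoˡ-≤ 0≤W #T>∧B=-increases ⟩
  #T>∧B= t b m ℓ₂ × W                     ≡⟨ Prob≡count×levelWeight s b _ (∧B=b⇒ ((T> ℓ₂) t)) ⟨
  Prob m s (λ x → (T> ℓ₂) t x ∧ (B= b) x) ∎)
  where
  open ℚ.≤-Reasoning
  #T>∧B=-increases : #T>∧B= t b m ℓ₁ ≤ #T>∧B= t b m ℓ₂
  #T>∧B=-increases = #T>∧B=-mono t b {m} (<⇒≤ ℓ₁<ℓ₂) (m≤n/2⇒m+m≤n ℓ₂≤m/2)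
  W = levelWeight m s b
  0≤W : 0ℚ ≤ℚ W
  0≤W = *-nonNeg (^-nonNeg b (ℚ.<⇒≤ 0<s)) (^-nonNeg (m ∸ b) (p≤q⇒0≤q-p (ℚ.<⇒≤ s<1)))
  B=b⇒ : ∀ x → Tᵇ ((B= b) x) → Bsum x ≡ b
  B=b⇒ x = ≡ᵇ⇒≡ (Bsum x) b
  ∧B=b⇒ : ∀ (A : Outcome m → Bool) x → Tᵇ (A x ∧ (B= b) x) → Bsum x ≡ b
  ∧B=b⇒ A x = B=b⇒ x ∘ proj₂ ∘ Equivalence.to (T-∧ {A x})
  0≤P[B=b] : 0ℚ ≤ℚ Prob m s (B= b)
  0≤P[B=b] = subst (0ℚ ≤ℚ_) (sym (Prob≡count×levelWeight s b (B= b) B=b⇒))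
                   (×-nonNeg (count (B= b) (allOutcomes m)) 0≤W)
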